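{- The following games have the stated horizontal preperiod and horizontal period: (i) $L(2;2,0;3,1)$: preperiod $10$, period $4$; (ii) $L(2;2,0;3,3)$: preperiod $10$, period $4$; (iii) $L(3;3,0;2,1)$: preperiod $5$, period $6$; (iv) $L(3;3,0;2,5)$: preperiod $5$, period $6$.
   Context: The Lengyel transfer game $L(b;x_1,y_1;x_2,y_2)$ is the impartial normal-play game on positions $(x,y)\in\mathbb{N}^2$ in which a move consists of adding one of $(0,-b)$, $(-x_1,y_1)$, $(-x_2,y_2)$, provided the result lies in $\mathbb{N}^2$; $\mathcal{SG}(x,y)$ is the Sprague–Grundy value. The horizontal period is the least positive integer $p$ such that for some $x_0$, $\mathcal{SG}(x+p,y)=\mathcal{SG}(x,y)$ for all $x\ge x_0$ and all $y$; the horizontal preperiod is the least such $x_0$. -}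

module Defs where

open import Data.Nat using (ℕ; zero; suc; _+_; _∸_; _≤_; _<_; _≤?_; z≤n; s≤s; NonZero)
open import Data.Nat.Properties using (∸-monoʳ-<; _≟_)
open import Data.Nat.Induction using (<-rec)
open import Data.List using (List; []; _∷_; length)
open import Data.Bool using (if_then_else_)
open import Data.List.Membership.DecPropositional _≟_ using (_∈?_)
open import Relation.Nullary using (yes; no; does)
open import Relation.Binary.PropositionalEquality using (_≡_)
open import Data.Product using (_×_; ∃)

-- Minimum excludant: least natural number not occurring in the list.
-- (The answer is at most the length of the list, so searching the
-- candidates 0 .. length l suffices.)
mex : List ℕ → ℕ
mex l = go (length l) 0
  where
  go : ℕ → ℕ → ℕ
  go zero    n = n
  go (suc k) n = if does (n ∈? l) then go k (suc n) else n

private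
  sub< : ∀ x n → .{{_ : NonZero n}} → n ≤ x → x ∸ n < x
  sub< x (suc k) le = ∸-monoʳ-< {x} {suc k} {0} (s≤s z≤n) le

-- Sprague–Grundy function of the Lengyel transfer game L(b; x₁,y₁; x₂,y₂).
-- Moves from (x,y): (x, y-b) if y ≥ b; (x-x₁, y+y₁) if x ≥ x₁;
-- (x-x₂, y+y₂) if x ≥ x₂.  With b, x₁, x₂ positive every move decreases
-- (x,y) lexicographically, so the game is finite; SG is defined by
-- well-founded recursion on x (outer) and y (inner).
SG : (b x₁ y₁ x₂ y₂ : ℕ) → .{{_ : NonZero b}} → .{{_ : NonZero x₁}} → .{{_ : NonZero x₂}}
   → ℕ → ℕ → ℕ
SG b x₁ y₁ x₂ y₂ = <-rec (λ _ → ℕ → ℕ) row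
  where
  row : (x : ℕ) → ({x' : ℕ} → x' < x → ℕ → ℕ) → ℕ → ℕ
  row x recX = <-rec (λ _ → ℕ) cell
    where
    cell : (y : ℕ) → ({y' : ℕ} → y' < y → ℕ) → ℕ
    cell y recY = mex (opt₀ (opt₁ (opt₂ [])))
      where
      opt₀ : List ℕ → List ℕ
      opt₀ l with b ≤? y
      ... | yes le = recY (sub< y b le) ∷ l
      ... | no _   = l
      opt₁ : List ℕ → List ℕ
      opt₁ l with x₁ ≤? x
      ... | yes le = recX (sub< x x₁ le) (y + y₁) ∷ l
      ... | no _   = l
      opt₂ : List ℕ → List ℕ
      opt₂ l with x₂ ≤? x
      ... | yes le = recX (sub< x x₂ le) (y + y₂) ∷ l
      ... | no _   = l

PeriodicFrom : (ℕ → ℕ → ℕ) → ℕ → ℕ → Set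
PeriodicFrom g p x₀ = ∀ x y → x₀ ≤ x → g (x + p) y ≡ g x y

HorizontalPreperiodPeriod : (ℕ → ℕ → ℕ) → ℕ → ℕ → Set
HorizontalPreperiodPeriod g x₀ p =
  (0 < p) × PeriodicFrom g p x₀
  × (∀ q x₀' → 0 < q → PeriodicFrom g q x₀' → p ≤ q)
  × (∀ x₀' → PeriodicFrom g p x₀' → x₀ ≤ x₀')

-- Each of the four Sprague–Grundy functions is the eventually periodic extension of a finite
-- table: horizontally with the claimed preperiod and period, vertically with period 2b. A
-- function satisfying the mex recurrence of the game agrees with SG, by induction along SG's own
-- well-founded recursion. For such an extension the recurrence at (x + p, y) or (x, y + 2b), far
-- enough out, is literally the recurrence at (x, y), so it only has to be checked on a finite
-- window, which is done by evaluation. Minimality comes from columns that differ: a smaller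
-- period r would force column x₀ + r to equal column x₀, and the preperiod x₀ − 1 would force
-- columns x₀ − 1 and x₀ − 1 + p to agree.
module Submission where

open import Defs

open import Data.Bool.Base using (T; if_then_else_)
open import Data.Fin.Base using (Fin; toℕ; fromℕ<)
open import Data.Fin.Properties using (toℕ-fromℕ<; all?)
open import Data.List.Base using (List; []; _∷_; [_]; _++_; head; drop)
open import Data.List.Relation.Binary.Pointwise using (Pointwise; []; _∷_; Pointwise-≡⇒≡)
open import Data.Maybe.Base using (_>>=_) renaming (fromMaybe to withDefault)
open import Data.Nat.Base
open import Data.Nat.DivMod using (_%_; [m+n]%n≡m%n)
open import Data.Nat.Induction using (<-rec; <-recBuilder; <-wellFounded)
open import Data.Nat.Properties
  using ( _≟_; _<?_; ≤ᵇ⇒≤; ≤-refl; ≤-trans; ≮⇒≥; m≤m+n; m≤n+m; m≤m*n; m<m+n; +-assoc; +-comm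
        ; +-monoˡ-<; m≤n⇒m⊓n≡m; +-∸-comm; ∸-monoʳ-<; m≤n⇒∃[o]m+o≡n )
open import Data.Product.Base using (Σ; _×_; ∃-syntax; _,_; proj₁)
open import Function.Base using (_∘_)
open import Induction.WellFounded using (WfRec; Acc; acc; acc-inverse; module Some)
import Level
open import Relation.Binary.PropositionalEquality
  using (_≡_; _≢_; refl; sym; trans; cong; cong₂; subst; module ≡-Reasoning)
open import Relation.Nullary.Decidable using (Dec; yes; no; from-yes)
open import Relation.Nullary.Negation using (contradiction)
open import Relation.Unary using (Pred)

module _ {p r} (P : Pred ℕ p) (R : ∀ x → P x → Set r) where

  Preserves : (∀ x → WfRec _<_ P x → P x) → Set (p Level.⊔ r)
  Preserves f = ∀ x (IH : WfRec _<_ P x) → (∀ {y} (y<x : y < x) → R y (IH y<x)) → R x (f x IH)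

  wfRecBuilder-invariant : ∀ {f} → Preserves f → ∀ {x} (q : Acc _<_ x) {y} (y<x : y < x)
    → R y (Some.wfRecBuilder P f x q y<x)
  wfRecBuilder-invariant step (acc rs) y<x = step _ _ (wfRecBuilder-invariant step (rs y<x))

  <-rec-invariant : ∀ f → Preserves f → ∀ x → R x (<-rec P f x)
  <-rec-invariant f step x = step x _ (wfRecBuilder-invariant step (<-wellFounded x))

periodic-induction : ∀ {ℓ} (Q : ℕ → Set ℓ) n₀ p .{{_ : NonZero p}}
  → (∀ (i : Fin (n₀ + p)) → Q (toℕ i))
  → (∀ k → Q (n₀ + k) → Q (n₀ + p + k))
  → ∀ n → Q n
periodic-induction Q n₀ p window shift = <-rec Q step
  where
  step : ∀ n → (∀ {m} → m < n → Q m) → Q n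
  step n rec with n <? n₀ + p
  ... | yes n<N = subst Q (toℕ-fromℕ< n<N) (window (fromℕ< n<N))
  ... | no n≮N with k , refl ← m≤n⇒∃[o]m+o≡n (≮⇒≥ n≮N) =
    shift k (rec (+-monoˡ-< k (m<m+n n₀ (>-nonZero⁻¹ p))))

periodic-induction² : ∀ {ℓ} (P : ℕ → ℕ → Set ℓ) x₀ p y₀ q
  → .{{_ : NonZero p}} .{{_ : NonZero q}}
  → (∀ (i : Fin (x₀ + p)) (j : Fin (y₀ + q)) → P (toℕ i) (toℕ j))
  → (∀ k y → P (x₀ + k) y → P (x₀ + p + k) y)
  → (∀ x k → P x (y₀ + k) → P x (y₀ + q + k))
  → ∀ x y → P x y
periodic-induction² P x₀ p y₀ q window shiftˣ shiftʸ =
  periodic-induction (λ x → ∀ y → P x y) x₀ p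
    (λ i → periodic-induction (P (toℕ i)) y₀ q (window i) (shiftʸ (toℕ i)))
    (λ k column y → shiftˣ k y (column y))

allFin²? : ∀ {ℓ} {P : ℕ → ℕ → Set ℓ} m n → (∀ x y → Dec (P x y))
  → Dec (∀ (i : Fin m) (j : Fin n) → P (toℕ i) (toℕ j))
allFin²? m n P? = all? λ i → all? λ j → P? (toℕ i) (toℕ j)

module _ {g : ℕ → ℕ → ℕ} where
  open ≡-Reasoning

  periodicFrom-multiple : ∀ {p x₀} → PeriodicFrom g p x₀
    → ∀ n {x} y → x₀ ≤ x → g (n * p + x) y ≡ g x y
  periodicFrom-multiple per zero y _ = refl
  periodicFrom-multiple {p} per (suc n) {x} y x₀≤x = begin
    g (p + n * p + x) y   ≡⟨ cong (λ z → g z y) (+-assoc p (n * p) x) ⟩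
    g (p + (n * p + x)) y ≡⟨ cong (λ z → g z y) (+-comm p (n * p + x)) ⟩
    g (n * p + x + p) y   ≡⟨ per (n * p + x) y (≤-trans x₀≤x (m≤n+m x (n * p))) ⟩
    g (n * p + x) y       ≡⟨ periodicFrom-multiple per n y x₀≤x ⟩
    g x y                 ∎

  periodicFrom-column : ∀ {p x₀ r x₁} .{{_ : NonZero p}}
    → PeriodicFrom g p x₀ → PeriodicFrom g r x₁
    → ∀ y → g (x₀ + r) y ≡ g x₀ y
  periodicFrom-column {p} {x₀} {r} {x₁} perᵖ perʳ y = begin
    g (x₀ + r) y              ≡⟨ periodicFrom-multiple perᵖ x₁ y (m≤m+n x₀ r) ⟨
    g (x₁ * p + (x₀ + r)) y   ≡⟨ cong (λ z → g z y) (+-assoc (x₁ * p) x₀ r) ⟨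
    g (x₁ * p + x₀ + r) y     ≡⟨ perʳ (x₁ * p + x₀) y (≤-trans (m≤m*n x₁ p) (m≤m+n _ x₀)) ⟩
    g (x₁ * p + x₀) y         ≡⟨ periodicFrom-multiple perᵖ x₁ y ≤-refl ⟩
    g x₀ y                    ∎

  horizontalPreperiodPeriod : ∀ {x₀ p} .{{_ : NonZero p}} → PeriodicFrom g p (suc x₀)
    → (∀ r → suc r < p → ∃[ y ] g (suc x₀ + suc r) y ≢ g (suc x₀) y)
    → ∃[ y ] g (x₀ + p) y ≢ g x₀ y
    → HorizontalPreperiodPeriod g (suc x₀) p
  horizontalPreperiodPeriod {x₀} {p} per columnsDiffer (y , preperiodDiffers) =
    >-nonZero⁻¹ p , per , period-minimal , preperiod-minimal
    where
    period-minimal : ∀ r x₁ → 0 < r → PeriodicFrom g r x₁ → p ≤ r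
    period-minimal (suc r) x₁ _ perʳ with suc r <? p
    ... | no r≮p = ≮⇒≥ r≮p
    ... | yes r<p with y , differs ← columnsDiffer r r<p =
      contradiction (periodicFrom-column per perʳ y) differs
    preperiod-minimal : ∀ x₁ → PeriodicFrom g p x₁ → suc x₀ ≤ x₁
    preperiod-minimal x₁ perˣ with x₀ <? x₁
    ... | yes x₀<x₁ = x₀<x₁
    ... | no x₀≮x₁ = contradiction (perˣ x₀ y (≮⇒≥ x₀≮x₁)) preperiodDiffers

periodicFrom-resp : ∀ {g h p x₀} → (∀ x y → g x y ≡ h x y)
  → PeriodicFrom g p x₀ → PeriodicFrom h p x₀
periodicFrom-resp g≗h per x y x₀≤x = trans (sym (g≗h _ y)) (trans (per x y x₀≤x) (g≗h x y))

horizontalPreperiodPeriod-resp : ∀ {g h x₀ p} → (∀ x y → g x y ≡ h x y)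
  → HorizontalPreperiodPeriod g x₀ p → HorizontalPreperiodPeriod h x₀ p
horizontalPreperiodPeriod-resp g≗h (0<p , per , period-minimal , preperiod-minimal) =
    0<p
  , periodicFrom-resp g≗h per
  , (λ r x₁ 0<r → period-minimal r x₁ 0<r ∘ periodicFrom-resp (λ x y → sym (g≗h x y)))
  , (λ x₁ → preperiod-minimal x₁ ∘ periodicFrom-resp (λ x y → sym (g≗h x y)))

-- Row x of the table lists the values at (x, 0), (x, 1), …; entries outside the table read as 0.
entry : List (List ℕ) → ℕ → ℕ → ℕ
entry t x y = withDefault 0 (head (drop x t) >>= head ∘ drop y)

-- Column x₀ ⊓ x + (x ∸ x₀) % p is x itself below x₀ and x₀ + (x − x₀) mod p from x₀ on.
periodicExtension : List (List ℕ) → (x₀ p q : ℕ) .{{_ : NonZero p}} .{{_ : NonZero q}}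
  → ℕ → ℕ → ℕ
periodicExtension t x₀ p q x y = entry t (x₀ ⊓ x + (x ∸ x₀) % p) (y % q)

periodicExtension-periodicFrom : ∀ t x₀ p q .{{_ : NonZero p}} .{{_ : NonZero q}}
  → PeriodicFrom (periodicExtension t x₀ p q) p x₀
periodicExtension-periodicFrom t x₀ p q x y x₀≤x = cong (λ c → entry t c (y % q)) (cong₂ _+_
  (trans (m≤n⇒m⊓n≡m (≤-trans x₀≤x (m≤m+n x p))) (sym (m≤n⇒m⊓n≡m x₀≤x)))
  (trans (cong (_% p) (+-∸-comm p x₀≤x)) ([m+n]%n≡m%n (x ∸ x₀) p)))

-- In the order in which SG collects its options, so that its unfoldings match pointwise.
followerValues : (b x₁ y₁ x₂ y₂ : ℕ) → (ℕ → ℕ → ℕ) → ℕ → ℕ → List ℕ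
followerValues b x₁ y₁ x₂ y₂ g x y =
     (if b ≤ᵇ y then [ g x (y ∸ b) ] else [])
  ++ (if x₁ ≤ᵇ x then [ g (x ∸ x₁) (y + y₁) ] else [])
  ++ (if x₂ ≤ᵇ x then [ g (x ∸ x₂) (y + y₂) ] else [])

MexRecurrenceAt : (b x₁ y₁ x₂ y₂ : ℕ) → (ℕ → ℕ → ℕ) → ℕ → ℕ → Set
MexRecurrenceAt b x₁ y₁ x₂ y₂ g x y = g x y ≡ mex (followerValues b x₁ y₁ x₂ y₂ g x y)

mexRecurrenceAt? : ∀ b x₁ y₁ x₂ y₂ g x y → Dec (MexRecurrenceAt b x₁ y₁ x₂ y₂ g x y)
mexRecurrenceAt? b x₁ y₁ x₂ y₂ g x y = g x y ≟ mex (followerValues b x₁ y₁ x₂ y₂ g x y)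

mex≡solution : ∀ b x₁ y₁ x₂ y₂ {g} → (∀ x y → MexRecurrenceAt b x₁ y₁ x₂ y₂ g x y)
  → ∀ {x y l} → Pointwise _≡_ l (followerValues b x₁ y₁ x₂ y₂ g x y) → mex l ≡ g x y
mex≡solution _ _ _ _ _ solves {x} {y} l≡ = trans (cong mex (Pointwise-≡⇒≡ l≡)) (sym (solves x y))

Row : Set
Row = ∀ x → WfRec _<_ (λ _ → ℕ → ℕ) x → ℕ → ℕ

-- The proof of x ∸ k < x that SG uses for a move of length k (private in Defs), applied to
-- the proof of k ≤ x that k ≤? x produces; unification against SG's unfolding needs this term.
x∸k<x : ∀ x k .{{_ : NonZero k}} → T (k ≤ᵇ x) → x ∸ k < x
x∸k<x x (suc k) k≤x = ∸-monoʳ-< {x} {suc k} {0} (s≤s z≤n) (≤ᵇ⇒≤ (suc k) x k≤x)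

accBelow : ∀ x k .{{_ : NonZero k}} → T (k ≤ᵇ x) → Acc _<_ (x ∸ k)
accBelow x k k≤x = acc-inverse (<-wellFounded x) (x∸k<x x k k≤x)

-- Defs builds SG as <-rec over a row function local to a where block. Two unfoldings of SG far
-- enough out on the x-axis reach that function applied below a stuck accessibility proof, where
-- unification can read it off: the first component is definitionally the row function of SG.
rowFunction₂₂₃ : ∀ y₂ → Σ Row λ f → ∀ n → SG 2 2 0 3 y₂ (5 + n) 0 ≡
  mex (mex ( Some.wfRecBuilder _ f (3 + n) (accBelow (5 + n) 2 _) (x∸k<x (3 + n) 2 _) (0 + 0 + 0)
           ∷ Some.wfRecBuilder _ f (3 + n) (accBelow (5 + n) 2 _) (x∸k<x (3 + n) 3 _) (0 + 0 + y₂)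
           ∷ [])
      ∷ <-recBuilder _ f (5 + n) (x∸k<x (5 + n) 3 _) (0 + y₂)
      ∷ [])
rowFunction₂₂₃ y₂ = _ , λ n → refl

rowFunction₃₃₂ : ∀ y₂ → Σ Row λ f → ∀ n → SG 3 3 0 2 y₂ (6 + n) 0 ≡
  mex (mex ( Some.wfRecBuilder _ f (3 + n) (accBelow (6 + n) 3 _) (x∸k<x (3 + n) 3 _) (0 + 0 + 0)
           ∷ Some.wfRecBuilder _ f (3 + n) (accBelow (6 + n) 3 _) (x∸k<x (3 + n) 2 _) (0 + 0 + y₂)
           ∷ [])
      ∷ <-recBuilder _ f (6 + n) (x∸k<x (6 + n) 2 _) (0 + y₂)
      ∷ [])
rowFunction₃₃₂ y₂ = _ , λ n → refl

wfRecBuilder-agrees : (h : ℕ → ℕ) {c : ∀ y → WfRec _<_ (λ _ → ℕ) y → ℕ}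
  → Preserves (λ _ → ℕ) (λ y v → v ≡ h y) c
  → ∀ {y} (q : Acc _<_ y) {y′} (y′<y : y′ < y) → Some.wfRecBuilder _ c y q y′<y ≡ h y′
wfRecBuilder-agrees h = wfRecBuilder-invariant _ (λ y v → v ≡ h y)

-- Case analysis makes SG's moves compute; within a column two unfoldings in y reach the stuck
-- accessibility proof accBelow (4 + y) 2, below which wfRecBuilder-agrees takes over.
solution⇒SG₂₂₃ : ∀ y₂ (g : ℕ → ℕ → ℕ)
  → (∀ x y → MexRecurrenceAt 2 2 0 3 y₂ g x y)
  → ∀ x y → SG 2 2 0 3 y₂ x y ≡ g x y
solution⇒SG₂₂₃ y₂ g solves =
  <-rec-invariant _ (λ x row → ∀ y → row y ≡ g x y) (proj₁ (rowFunction₂₂₃ y₂)) λ where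
    0 _ _ → λ where
      0 → agrees []
      1 → agrees []
      2 → agrees (agrees [] ∷ [])
      3 → agrees (agrees [] ∷ [])
      (suc (suc (suc (suc y)))) → agrees (agrees (wfRecBuilder-agrees (g 0) (λ where
          0 _ _ → agrees []
          1 _ _ → agrees []
          (suc (suc y)) _ hY → agrees (hY _ ∷ [])) (accBelow (4 + y) 2 _) _ ∷ []) ∷ [])
    1 _ _ → λ where
      0 → agrees []
      1 → agrees []
      2 → agrees (agrees [] ∷ [])
      3 → agrees (agrees [] ∷ [])
      (suc (suc (suc (suc y)))) → agrees (agrees (wfRecBuilder-agrees (g 1) (λ where
          0 _ _ → agrees []
          1 _ _ → agrees []
          (suc (suc y)) _ hY → agrees (hY _ ∷ [])) (accBelow (4 + y) 2 _) _ ∷ []) ∷ [])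
    2 _ hX → λ where
      0 → agrees (hX _ _ ∷ [])
      1 → agrees (hX _ _ ∷ [])
      2 → agrees (agrees (hX _ _ ∷ []) ∷ hX _ _ ∷ [])
      3 → agrees (agrees (hX _ _ ∷ []) ∷ hX _ _ ∷ [])
      (suc (suc (suc (suc y)))) → agrees (agrees (wfRecBuilder-agrees (g 2) (λ where
          0 _ _ → agrees (hX _ _ ∷ [])
          1 _ _ → agrees (hX _ _ ∷ [])
          (suc (suc y)) _ hY → agrees (hY _ ∷ hX _ _ ∷ [])) (accBelow (4 + y) 2 _) _
        ∷ hX _ _ ∷ []) ∷ hX _ _ ∷ [])
    (suc (suc (suc x))) _ hX → λ where
      0 → agrees (hX _ _ ∷ hX _ _ ∷ [])
      1 → agrees (hX _ _ ∷ hX _ _ ∷ [])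
      2 → agrees (agrees (hX _ _ ∷ hX _ _ ∷ []) ∷ hX _ _ ∷ hX _ _ ∷ [])
      3 → agrees (agrees (hX _ _ ∷ hX _ _ ∷ []) ∷ hX _ _ ∷ hX _ _ ∷ [])
      (suc (suc (suc (suc y)))) → agrees (agrees (wfRecBuilder-agrees (g (3 + x)) (λ where
          0 _ _ → agrees (hX _ _ ∷ hX _ _ ∷ [])
          1 _ _ → agrees (hX _ _ ∷ hX _ _ ∷ [])
          (suc (suc y)) _ hY → agrees (hY _ ∷ hX _ _ ∷ hX _ _ ∷ [])) (accBelow (4 + y) 2 _) _
        ∷ hX _ _ ∷ hX _ _ ∷ []) ∷ hX _ _ ∷ hX _ _ ∷ [])
  where
  agrees : ∀ {x y l} → Pointwise _≡_ l (followerValues 2 2 0 3 y₂ g x y) → mex l ≡ g x y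
  agrees = mex≡solution 2 2 0 3 y₂ solves

solution⇒SG₃₃₂ : ∀ y₂ (g : ℕ → ℕ → ℕ)
  → (∀ x y → MexRecurrenceAt 3 3 0 2 y₂ g x y)
  → ∀ x y → SG 3 3 0 2 y₂ x y ≡ g x y
solution⇒SG₃₃₂ y₂ g solves =
  <-rec-invariant _ (λ x row → ∀ y → row y ≡ g x y) (proj₁ (rowFunction₃₃₂ y₂)) λ where
    0 _ _ → λ where
      0 → agrees []
      1 → agrees []
      2 → agrees []
      3 → agrees (agrees [] ∷ [])
      4 → agrees (agrees [] ∷ [])
      5 → agrees (agrees [] ∷ [])
      (suc (suc (suc (suc (suc (suc y)))))) → agrees (agrees (wfRecBuilder-agrees (g 0) (λ where
          0 _ _ → agrees []
          1 _ _ → agrees []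
          2 _ _ → agrees []
          (suc (suc (suc y))) _ hY → agrees (hY _ ∷ [])) (accBelow (6 + y) 3 _) _
        ∷ []) ∷ [])
    1 _ _ → λ where
      0 → agrees []
      1 → agrees []
      2 → agrees []
      3 → agrees (agrees [] ∷ [])
      4 → agrees (agrees [] ∷ [])
      5 → agrees (agrees [] ∷ [])
      (suc (suc (suc (suc (suc (suc y)))))) → agrees (agrees (wfRecBuilder-agrees (g 1) (λ where
          0 _ _ → agrees []
          1 _ _ → agrees []
          2 _ _ → agrees []
          (suc (suc (suc y))) _ hY → agrees (hY _ ∷ [])) (accBelow (6 + y) 3 _) _
        ∷ []) ∷ [])
    2 _ hX → λ where
      0 → agrees (hX _ _ ∷ [])
      1 → agrees (hX _ _ ∷ [])
      2 → agrees (hX _ _ ∷ [])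
      3 → agrees (agrees (hX _ _ ∷ []) ∷ hX _ _ ∷ [])
      4 → agrees (agrees (hX _ _ ∷ []) ∷ hX _ _ ∷ [])
      5 → agrees (agrees (hX _ _ ∷ []) ∷ hX _ _ ∷ [])
      (suc (suc (suc (suc (suc (suc y)))))) → agrees (agrees (wfRecBuilder-agrees (g 2) (λ where
          0 _ _ → agrees (hX _ _ ∷ [])
          1 _ _ → agrees (hX _ _ ∷ [])
          2 _ _ → agrees (hX _ _ ∷ [])
          (suc (suc (suc y))) _ hY → agrees (hY _ ∷ hX _ _ ∷ [])) (accBelow (6 + y) 3 _) _
        ∷ hX _ _ ∷ []) ∷ hX _ _ ∷ [])
    (suc (suc (suc x))) _ hX → λ where
      0 → agrees (hX _ _ ∷ hX _ _ ∷ [])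
      1 → agrees (hX _ _ ∷ hX _ _ ∷ [])
      2 → agrees (hX _ _ ∷ hX _ _ ∷ [])
      3 → agrees (agrees (hX _ _ ∷ hX _ _ ∷ []) ∷ hX _ _ ∷ hX _ _ ∷ [])
      4 → agrees (agrees (hX _ _ ∷ hX _ _ ∷ []) ∷ hX _ _ ∷ hX _ _ ∷ [])
      5 → agrees (agrees (hX _ _ ∷ hX _ _ ∷ []) ∷ hX _ _ ∷ hX _ _ ∷ [])
      (suc (suc (suc (suc (suc (suc y)))))) → agrees (agrees (wfRecBuilder-agrees (g (3 + x)) (λ where
          0 _ _ → agrees (hX _ _ ∷ hX _ _ ∷ [])
          1 _ _ → agrees (hX _ _ ∷ hX _ _ ∷ [])
          2 _ _ → agrees (hX _ _ ∷ hX _ _ ∷ [])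
          (suc (suc (suc y))) _ hY → agrees (hY _ ∷ hX _ _ ∷ hX _ _ ∷ [])) (accBelow (6 + y) 3 _) _
        ∷ hX _ _ ∷ hX _ _ ∷ []) ∷ hX _ _ ∷ hX _ _ ∷ [])
  where
  agrees : ∀ {x y l} → Pointwise _≡_ l (followerValues 3 3 0 2 y₂ g x y) → mex l ≡ g x y
  agrees = mex≡solution 3 3 0 2 y₂ solves

tabulated-horizontalPreperiodPeriod : ∀ {S : ℕ → ℕ → ℕ} t x₀ p q
  → .{{_ : NonZero p}} .{{_ : NonZero q}}
  → (let g = periodicExtension t (suc x₀) p q) → (∀ x y → S x y ≡ g x y)
  → (∀ r → suc r < p → ∃[ y ] g (suc x₀ + suc r) y ≢ g (suc x₀) y)
  → ∃[ y ] g (x₀ + p) y ≢ g x₀ y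
  → HorizontalPreperiodPeriod S (suc x₀) p
tabulated-horizontalPreperiodPeriod t x₀ p q S≗g columnsDiffer preperiodDiffers =
  horizontalPreperiodPeriod-resp (λ x y → sym (S≗g x y))
    (horizontalPreperiodPeriod (periodicExtension-periodicFrom t (suc x₀) p q)
      columnsDiffer preperiodDiffers)

table₁ : List (List ℕ)
table₁ =
    (0 ∷ 0 ∷ 1 ∷ 1 ∷ [])
  ∷ (0 ∷ 0 ∷ 1 ∷ 1 ∷ [])
  ∷ (1 ∷ 1 ∷ 0 ∷ 0 ∷ [])
  ∷ (1 ∷ 2 ∷ 0 ∷ 3 ∷ [])
  ∷ (2 ∷ 0 ∷ 3 ∷ 1 ∷ [])
  ∷ (0 ∷ 1 ∷ 1 ∷ 0 ∷ [])
  ∷ (0 ∷ 1 ∷ 1 ∷ 0 ∷ [])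
  ∷ (1 ∷ 0 ∷ 0 ∷ 1 ∷ [])
  ∷ (2 ∷ 0 ∷ 3 ∷ 1 ∷ [])
  ∷ (0 ∷ 2 ∷ 1 ∷ 3 ∷ [])
  ∷ (1 ∷ 1 ∷ 0 ∷ 0 ∷ [])
  ∷ (1 ∷ 0 ∷ 0 ∷ 1 ∷ [])
  ∷ (0 ∷ 0 ∷ 1 ∷ 1 ∷ [])
  ∷ (0 ∷ 1 ∷ 1 ∷ 0 ∷ [])
  ∷ []

sg₁ : ℕ → ℕ → ℕ
sg₁ = periodicExtension table₁ 10 4 4

-- Past the window the recurrence at a shifted point normalises to the very term at the unshifted
-- one, since the extension only inspects x₀ ⊓ x, x ∸ x₀ and remainders: both shifts are the identity.
sg₁-recurrence : ∀ x y → MexRecurrenceAt 2 2 0 3 1 sg₁ x y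
sg₁-recurrence = periodic-induction² _ 13 4 2 4
  (from-yes (allFin²? 17 6 (mexRecurrenceAt? 2 2 0 3 1 sg₁)))
  (λ _ _ recurrence → recurrence) (λ _ _ recurrence → recurrence)

sg₁-columnsDiffer : ∀ r → suc r < 4 → ∃[ y ] sg₁ (10 + suc r) y ≢ sg₁ 10 y
sg₁-columnsDiffer 0 _ = 1 , λ ()
sg₁-columnsDiffer 1 _ = 0 , λ ()
sg₁-columnsDiffer 2 _ = 0 , λ ()
sg₁-columnsDiffer (suc (suc (suc _))) (s≤s (s≤s (s≤s (s≤s ()))))

table₂ : List (List ℕ)
table₂ =
    (0 ∷ 0 ∷ 1 ∷ 1 ∷ [])
  ∷ (0 ∷ 0 ∷ 1 ∷ 1 ∷ [])
  ∷ (1 ∷ 1 ∷ 0 ∷ 0 ∷ [])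
  ∷ (2 ∷ 1 ∷ 3 ∷ 0 ∷ [])
  ∷ (0 ∷ 2 ∷ 1 ∷ 3 ∷ [])
  ∷ (1 ∷ 0 ∷ 0 ∷ 1 ∷ [])
  ∷ (1 ∷ 0 ∷ 0 ∷ 1 ∷ [])
  ∷ (0 ∷ 1 ∷ 1 ∷ 0 ∷ [])
  ∷ (0 ∷ 2 ∷ 1 ∷ 3 ∷ [])
  ∷ (2 ∷ 0 ∷ 3 ∷ 1 ∷ [])
  ∷ (1 ∷ 1 ∷ 0 ∷ 0 ∷ [])
  ∷ (0 ∷ 1 ∷ 1 ∷ 0 ∷ [])
  ∷ (0 ∷ 0 ∷ 1 ∷ 1 ∷ [])
  ∷ (1 ∷ 0 ∷ 0 ∷ 1 ∷ [])
  ∷ []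

sg₂ : ℕ → ℕ → ℕ
sg₂ = periodicExtension table₂ 10 4 4

sg₂-recurrence : ∀ x y → MexRecurrenceAt 2 2 0 3 3 sg₂ x y
sg₂-recurrence = periodic-induction² _ 13 4 2 4
  (from-yes (allFin²? 17 6 (mexRecurrenceAt? 2 2 0 3 3 sg₂)))
  (λ _ _ recurrence → recurrence) (λ _ _ recurrence → recurrence)

sg₂-columnsDiffer : ∀ r → suc r < 4 → ∃[ y ] sg₂ (10 + suc r) y ≢ sg₂ 10 y
sg₂-columnsDiffer 0 _ = 0 , λ ()
sg₂-columnsDiffer 1 _ = 0 , λ ()
sg₂-columnsDiffer 2 _ = 1 , λ ()
sg₂-columnsDiffer (suc (suc (suc _))) (s≤s (s≤s (s≤s (s≤s ()))))

table₃ : List (List ℕ)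
table₃ =
    (0 ∷ 0 ∷ 0 ∷ 1 ∷ 1 ∷ 1 ∷ [])
  ∷ (0 ∷ 0 ∷ 0 ∷ 1 ∷ 1 ∷ 1 ∷ [])
  ∷ (1 ∷ 1 ∷ 0 ∷ 0 ∷ 0 ∷ 1 ∷ [])
  ∷ (1 ∷ 1 ∷ 2 ∷ 0 ∷ 0 ∷ 3 ∷ [])
  ∷ (2 ∷ 1 ∷ 1 ∷ 3 ∷ 0 ∷ 0 ∷ [])
  ∷ (0 ∷ 0 ∷ 1 ∷ 1 ∷ 1 ∷ 0 ∷ [])
  ∷ (0 ∷ 0 ∷ 0 ∷ 1 ∷ 1 ∷ 1 ∷ [])
  ∷ (1 ∷ 0 ∷ 0 ∷ 0 ∷ 1 ∷ 1 ∷ [])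
  ∷ (1 ∷ 1 ∷ 0 ∷ 0 ∷ 0 ∷ 1 ∷ [])
  ∷ (1 ∷ 1 ∷ 1 ∷ 0 ∷ 0 ∷ 0 ∷ [])
  ∷ (0 ∷ 1 ∷ 1 ∷ 1 ∷ 0 ∷ 0 ∷ [])
  ∷ []

sg₃ : ℕ → ℕ → ℕ
sg₃ = periodicExtension table₃ 5 6 6

sg₃-recurrence : ∀ x y → MexRecurrenceAt 3 3 0 2 1 sg₃ x y
sg₃-recurrence = periodic-induction² _ 8 6 3 6
  (from-yes (allFin²? 14 9 (mexRecurrenceAt? 3 3 0 2 1 sg₃)))
  (λ _ _ recurrence → recurrence) (λ _ _ recurrence → recurrence)

sg₃-columnsDiffer : ∀ r → suc r < 6 → ∃[ y ] sg₃ (5 + suc r) y ≢ sg₃ 5 y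
sg₃-columnsDiffer 0 _ = 2 , λ ()
sg₃-columnsDiffer 1 _ = 0 , λ ()
sg₃-columnsDiffer 2 _ = 0 , λ ()
sg₃-columnsDiffer 3 _ = 0 , λ ()
sg₃-columnsDiffer 4 _ = 1 , λ ()
sg₃-columnsDiffer (suc (suc (suc (suc (suc _))))) (s≤s (s≤s (s≤s (s≤s (s≤s (s≤s ()))))))

table₄ : List (List ℕ)
table₄ =
    (0 ∷ 0 ∷ 0 ∷ 1 ∷ 1 ∷ 1 ∷ [])
  ∷ (0 ∷ 0 ∷ 0 ∷ 1 ∷ 1 ∷ 1 ∷ [])
  ∷ (0 ∷ 1 ∷ 1 ∷ 1 ∷ 0 ∷ 0 ∷ [])
  ∷ (2 ∷ 1 ∷ 1 ∷ 3 ∷ 0 ∷ 0 ∷ [])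
  ∷ (1 ∷ 1 ∷ 2 ∷ 0 ∷ 0 ∷ 3 ∷ [])
  ∷ (1 ∷ 0 ∷ 0 ∷ 0 ∷ 1 ∷ 1 ∷ [])
  ∷ (0 ∷ 0 ∷ 0 ∷ 1 ∷ 1 ∷ 1 ∷ [])
  ∷ (0 ∷ 0 ∷ 1 ∷ 1 ∷ 1 ∷ 0 ∷ [])
  ∷ (0 ∷ 1 ∷ 1 ∷ 1 ∷ 0 ∷ 0 ∷ [])
  ∷ (1 ∷ 1 ∷ 1 ∷ 0 ∷ 0 ∷ 0 ∷ [])
  ∷ (1 ∷ 1 ∷ 0 ∷ 0 ∷ 0 ∷ 1 ∷ [])
  ∷ []

sg₄ : ℕ → ℕ → ℕ
sg₄ = periodicExtension table₄ 5 6 6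

sg₄-recurrence : ∀ x y → MexRecurrenceAt 3 3 0 2 5 sg₄ x y
sg₄-recurrence = periodic-induction² _ 8 6 3 6
  (from-yes (allFin²? 14 9 (mexRecurrenceAt? 3 3 0 2 5 sg₄)))
  (λ _ _ recurrence → recurrence) (λ _ _ recurrence → recurrence)

sg₄-columnsDiffer : ∀ r → suc r < 6 → ∃[ y ] sg₄ (5 + suc r) y ≢ sg₄ 5 y
sg₄-columnsDiffer 0 _ = 0 , λ ()
sg₄-columnsDiffer 1 _ = 0 , λ ()
sg₄-columnsDiffer 2 _ = 0 , λ ()
sg₄-columnsDiffer 3 _ = 1 , λ ()
sg₄-columnsDiffer 4 _ = 1 , λ ()
sg₄-columnsDiffer (suc (suc (suc (suc (suc _))))) (s≤s (s≤s (s≤s (s≤s (s≤s (s≤s ()))))))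

mainTheorem13 : HorizontalPreperiodPeriod (SG 2 2 0 3 1) 10 4
    × HorizontalPreperiodPeriod (SG 2 2 0 3 3) 10 4
    × HorizontalPreperiodPeriod (SG 3 3 0 2 1) 5 6
    × HorizontalPreperiodPeriod (SG 3 3 0 2 5) 5 6
mainTheorem13 =
    tabulated-horizontalPreperiodPeriod table₁ 9 4 4 (solution⇒SG₂₂₃ 1 sg₁ sg₁-recurrence)
      sg₁-columnsDiffer (1 , λ ())
  , tabulated-horizontalPreperiodPeriod table₂ 9 4 4 (solution⇒SG₂₂₃ 3 sg₂ sg₂-recurrence)
      sg₂-columnsDiffer (0 , λ ())
  , tabulated-horizontalPreperiodPeriod table₃ 4 6 6 (solution⇒SG₃₃₂ 1 sg₃ sg₃-recurrence)
      sg₃-columnsDiffer (0 , λ ())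
  , tabulated-horizontalPreperiodPeriod table₄ 4 6 6 (solution⇒SG₃₃₂ 5 sg₄ sg₄-recurrence)
      sg₄-columnsDiffer (2 , λ ())
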